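{- Let $T'$ be a tree with a unique maximum open packing and with $\Delta(T')\ge 3$, and let $x$ be a leaf in $L(T')$. Suppose there is a path $x=u_0,u_1,\ldots,u_k$ in $T'$ with $\deg_{T'}(u_i)=2$ for $i\in\{1,\ldots,k-1\}$, $\deg_{T'}(u_k)=1$, and $k\ge 4$. Then the tree $T=T'-\{u_{k-3},\ldots,u_k\}$ has a unique maximum open packing. In addition, $T'$ is obtainable from $T$ by Operation 1 at $u_{k-4}$, where Operation 1 at a vertex $w$ of a graph $G$ having a unique maximum open packing $U(G)$ is allowed when $w$ and some neighbor of $w$ both belong to $U(G)$, and consists of appending a path $P_4$ to $w$ (adding a new path on 4 vertices and joining $w$ to one of its end vertices).
   Context: An open packing in a graph is a set of vertices whose open neighborhoods are pairwise disjoint. For a tree $T'$ with maximum degree $\Delta(T')\ge 3$, $L(T')$ is the tree whose vertices are the vertices of $T'$ of degree at least 3, two such vertices $p,q$ being adjacent in $L(T')$ if all internal vertices of the unique $p$–$q$ path in $T'$ have degree 2 in $T'$. -}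

module Defs where

open import Data.Nat using (ℕ; zero; suc; _≤_; _<_; _∸_)
open import Data.Bool using (Bool; true; false)
open import Data.Fin using (Fin)
open import Data.Fin.Subset using (Subset; _∈_; _∉_; _⊆_; ∣_∣; ⁅_⁆; _∪_; ∁)
open import Data.Vec using (tabulate)
open import Data.Product using (Σ; _×_; ∃)
open import Data.Sum using (_⊎_)
open import Relation.Binary.PropositionalEquality using (_≡_; _≢_)
open import Relation.Nullary using (¬_)

record Graph (n : ℕ) : Set where
  field
    adj    : Fin n → Fin n → Bool
    sym    : ∀ u v → adj u v ≡ adj v u
    irrefl : ∀ u → adj u u ≡ false

module _ {n : ℕ} (G : Graph n) where
  open Graph G

  Adj : Fin n → Fin n → Set
  Adj u v = adj u v ≡ true

  nbhd : Fin n → Subset n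
  nbhd u = tabulate (adj u)

  deg : Fin n → ℕ
  deg u = ∣ nbhd u ∣

  IsPath : ℕ → (ℕ → Fin n) → Set
  IsPath m w = (∀ i → i < m → Adj (w i) (w (suc i)))
             × (∀ i j → i ≤ m → j ≤ m → w i ≡ w j → i ≡ j)

  Connected : Set
  Connected = ∀ u v → Σ ℕ λ m → Σ (ℕ → Fin n) λ w →
                w 0 ≡ u × w m ≡ v × IsPath m w

  -- no cycle c 0, …, c m, c 0 with m ≥ 2 (length ≥ 3)
  Acyclic : Set
  Acyclic = ∀ m (c : ℕ → Fin n) → 2 ≤ m → IsPath m c → ¬ Adj (c m) (c 0)

  IsTree : Set
  IsTree = Connected × Acyclic

  MaxDegAtLeast3 : Set
  MaxDegAtLeast3 = ∃ λ v → 3 ≤ deg v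

  -- adjacency in L(G): p, q distinct vertices of degree ≥ 3 joined by a
  -- path all of whose internal vertices have degree 2
  LAdj : Fin n → Fin n → Set
  LAdj p q = p ≢ q × 3 ≤ deg p × 3 ≤ deg q ×
             (Σ ℕ λ m → Σ (ℕ → Fin n) λ w →
                w 0 ≡ p × w m ≡ q × IsPath m w ×
                (∀ i → 1 ≤ i → i < m → deg (w i) ≡ 2))

  -- x is a leaf of L(G): a vertex of L(G) with exactly one L(G)-neighbour
  LLeaf : Fin n → Set
  LLeaf x = 3 ≤ deg x × Σ (Fin n) λ q → LAdj x q × (∀ q' → LAdj x q' → q' ≡ q)

  -- Open packings of the induced subgraph G[W]: S ⊆ W and the open
  -- neighbourhoods (in G[W]) of distinct vertices of S are disjoint.
  IsOpenPacking : Subset n → Subset n → Set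
  IsOpenPacking W S = S ⊆ W ×
    (∀ a b v → a ∈ S → b ∈ S → v ∈ W → Adj a v → Adj b v → a ≡ b)

  IsMaxOpenPacking : Subset n → Subset n → Set
  IsMaxOpenPacking W S = IsOpenPacking W S ×
    (∀ S' → IsOpenPacking W S' → ∣ S' ∣ ≤ ∣ S ∣)

  IsUniqueMaxOpenPacking : Subset n → Subset n → Set
  IsUniqueMaxOpenPacking W S = IsMaxOpenPacking W S ×
    (∀ S' → IsMaxOpenPacking W S' → S' ≡ S)

  HasUniqueMaxOpenPacking : Subset n → Set
  HasUniqueMaxOpenPacking W = Σ (Subset n) λ S → IsUniqueMaxOpenPacking W S

  Op1Allowed : Subset n → Fin n → Set
  Op1Allowed W w = w ∈ W × Σ (Subset n) λ U → IsUniqueMaxOpenPacking W U ×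
    w ∈ U × Σ (Fin n) λ v → v ∈ W × Adj w v × v ∈ U

  P4Edge : Fin n → Fin n → Fin n → Fin n → Fin n → Fin n → Fin n → Set
  P4Edge w a b c d x y =
      (x ≡ w × y ≡ a) ⊎ (x ≡ a × y ≡ w)
    ⊎ (x ≡ a × y ≡ b) ⊎ (x ≡ b × y ≡ a)
    ⊎ (x ≡ b × y ≡ c) ⊎ (x ≡ c × y ≡ b)
    ⊎ (x ≡ c × y ≡ d) ⊎ (x ≡ d × y ≡ c)

  -- G is obtained from G[W] by adding a new path a b c d and joining w to a
  IsP4Append : Subset n → Fin n → Fin n → Fin n → Fin n → Fin n → Set
  IsP4Append W w a b c d =
    w ∈ W × a ∉ W × b ∉ W × c ∉ W × d ∉ W ×
    a ≢ b × a ≢ c × a ≢ d × b ≢ c × b ≢ d × c ≢ d ×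
    (∀ v → v ∈ W ⊎ (v ≡ a ⊎ v ≡ b ⊎ v ≡ c ⊎ v ≡ d)) ×
    (∀ x y → (x ∉ W ⊎ y ∉ W) →
       (Adj x y → P4Edge w a b c d x y) × (P4Edge w a b c d x y → Adj x y))

  ObtainableByOp1 : Subset n → Fin n → Set
  ObtainableByOp1 W w = Op1Allowed W w ×
    Σ (Fin n) λ a → Σ (Fin n) λ b → Σ (Fin n) λ c → Σ (Fin n) λ d →
      IsP4Append W w a b c d

remaining : {n : ℕ} → ℕ → (ℕ → Fin n) → Subset n
remaining k u = ∁ (⁅ u (k ∸ 3) ⁆ ∪ (⁅ u (k ∸ 2) ⁆ ∪ (⁅ u (k ∸ 1) ⁆ ∪ ⁅ u k ⁆)))

module Submission where

-- Let w = u(k-4), a, b, c, d = u(k-3), …, u(k) and let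
-- W be the vertex set of T = T' − {a,b,c,d}.  Only the local structure of
-- the pendant path w–a–b–c–d matters (a, b, c have degree 2 and d is a
-- leaf).
-- Hence, with U' = U(T'), the set U = U' ∩ W is a maximum open packing of
-- T, and any maximum open packing S of T gives a maximum packing
-- S ∪ {c,d} of T', which must be U'; so S = U.  Finally U' = U ∪ {c,d} is
-- the only maximum packing of the form U ∪ {p,q} with p,q on the path; as
-- U ∪ {b,c} would be a packing if w ∉ U, and U ∪ {a,d} if w had no
-- neighbour in U, Operation 1 is allowed at w, and T' is T with a P4
-- appended at w.

open import Defs
open import Data.Nat using (ℕ; _≤_; _<_; _∸_)
open import Data.Fin using (Fin)
open import Data.Fin.Subset using (⊤)
open import Data.Product using (_×_)
open import Relation.Binary.PropositionalEquality using (_≡_)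

open import Data.Nat using (zero; suc; _+_; s≤s; z≤n)
open import Data.Nat.Properties
  using (≤-refl; ≤-trans; <⇒≤; <⇒≢; 1+n≰n; m≤n+m; m<n+m; +-cancelˡ-≤; module ≤-Reasoning)
open import Data.Bool using (true; false)
open import Data.Bool.Properties using () renaming (_≟_ to _≟𝔹_)
open import Data.Vec using (_∷_; here; there)
open import Data.Vec.Properties using (lookup∘tabulate; lookup⇒[]=)
open import Data.Fin using (zero; suc)
open import Data.Fin.Properties using (any?)
open import Data.Fin.Subset using (Subset; _∈_; _∉_; _⊆_; ∣_∣; ⁅_⁆; _∪_; _∩_; ∁)
open import Data.Fin.Subset.Properties
  using (_∈?_; ∈⊤; ∣p∣≤∣x∷p∣; ∣⁅x⁆∣≡1; ∪-identityˡ; p⊆q⇒∣p∣≤∣q∣; ⊆-antisym;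
         x∈⁅x⁆; x∈⁅y⁆⇒x≡y; x∈p∪q⁺; x∈p∪q⁻; x∈p∩q⁺; x∈p∩q⁻;
         x∈p⇒x∉∁p; x∉∁p⇒x∈p; x∉p⇒x∈∁p)
open import Data.Product using (Σ; _,_; proj₁; proj₂)
open import Data.Sum using (_⊎_; inj₁; inj₂)
open import Data.Empty using (⊥-elim)
open import Function using (_∘_)
open import Relation.Nullary using (¬_; yes; no)
open import Relation.Nullary.Decidable using (_×-dec_)
open import Relation.Binary.PropositionalEquality using (_≢_; refl; sym; trans; subst; cong)

∣⁅x⁆∪p∣≤1+∣p∣ : ∀ {n} (x : Fin n) (p : Subset n) → ∣ ⁅ x ⁆ ∪ p ∣ ≤ suc ∣ p ∣
∣⁅x⁆∪p∣≤1+∣p∣ zero    (s ∷ p) rewrite ∪-identityˡ p = s≤s (∣p∣≤∣x∷p∣ s p)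
∣⁅x⁆∪p∣≤1+∣p∣ (suc x) (false ∷ p) = ∣⁅x⁆∪p∣≤1+∣p∣ x p
∣⁅x⁆∪p∣≤1+∣p∣ (suc x) (true ∷ p)  = s≤s (∣⁅x⁆∪p∣≤1+∣p∣ x p)

∣⁅x⁆∪p∣≡1+∣p∣ : ∀ {n} (x : Fin n) (p : Subset n) → x ∉ p → ∣ ⁅ x ⁆ ∪ p ∣ ≡ suc ∣ p ∣
∣⁅x⁆∪p∣≡1+∣p∣ zero    (true ∷ p)  x∉p = ⊥-elim (x∉p here)
∣⁅x⁆∪p∣≡1+∣p∣ zero    (false ∷ p) _   = cong (suc ∘ ∣_∣) (∪-identityˡ p)
∣⁅x⁆∪p∣≡1+∣p∣ (suc x) (false ∷ p) x∉p = ∣⁅x⁆∪p∣≡1+∣p∣ x p (x∉p ∘ there)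
∣⁅x⁆∪p∣≡1+∣p∣ (suc x) (true ∷ p)  x∉p = cong suc (∣⁅x⁆∪p∣≡1+∣p∣ x p (x∉p ∘ there))

∈⁅y⁆∪p⁻ : ∀ {n} {x y : Fin n} {p : Subset n} → x ∈ ⁅ y ⁆ ∪ p → x ≡ y ⊎ x ∈ p
∈⁅y⁆∪p⁻ {y = y} {p} x∈ with x∈p∪q⁻ ⁅ y ⁆ p x∈
... | inj₁ x∈⁅y⁆ = inj₁ (x∈⁅y⁆⇒x≡y y x∈⁅y⁆)
... | inj₂ x∈p   = inj₂ x∈p

⁅x⁆∪p⊆ : ∀ {n} {x : Fin n} {p q : Subset n} → x ∈ q → p ⊆ q → ⁅ x ⁆ ∪ p ⊆ q
⁅x⁆∪p⊆ x∈q p⊆q z∈ with ∈⁅y⁆∪p⁻ z∈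
... | inj₁ refl = x∈q
... | inj₂ z∈p  = p⊆q z∈p

⁅_,_⁆∪_ : ∀ {n} → Fin n → Fin n → Subset n → Subset n
⁅ p , q ⁆∪ S = ⁅ p ⁆ ∪ (⁅ q ⁆ ∪ S)

∈⁅p,q⁆∪S⁻ : ∀ {n} {x p q : Fin n} {S : Subset n} → x ∈ ⁅ p , q ⁆∪ S → x ≡ p ⊎ x ≡ q ⊎ x ∈ S
∈⁅p,q⁆∪S⁻ x∈ with ∈⁅y⁆∪p⁻ x∈
... | inj₁ x≡p = inj₁ x≡p
... | inj₂ x∈ʳ = inj₂ (∈⁅y⁆∪p⁻ x∈ʳ)

∈⁅p,q⁆∪S⁺ : ∀ {n} {x p q : Fin n} {S : Subset n} → x ≡ p ⊎ x ≡ q ⊎ x ∈ S → x ∈ ⁅ p , q ⁆∪ S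
∈⁅p,q⁆∪S⁺ {p = p} (inj₁ refl)        = x∈p∪q⁺ (inj₁ (x∈⁅x⁆ p))
∈⁅p,q⁆∪S⁺ {q = q} (inj₂ (inj₁ refl)) = x∈p∪q⁺ (inj₂ (x∈p∪q⁺ (inj₁ (x∈⁅x⁆ q))))
∈⁅p,q⁆∪S⁺ (inj₂ (inj₂ x∈S))          = x∈p∪q⁺ (inj₂ (x∈p∪q⁺ (inj₂ x∈S)))

∣⁅p,q⁆∪S∣≤2+∣S∣ : ∀ {n} (p q : Fin n) (S : Subset n) → ∣ ⁅ p , q ⁆∪ S ∣ ≤ 2 + ∣ S ∣
∣⁅p,q⁆∪S∣≤2+∣S∣ p q S = ≤-trans (∣⁅x⁆∪p∣≤1+∣p∣ p (⁅ q ⁆ ∪ S)) (s≤s (∣⁅x⁆∪p∣≤1+∣p∣ q S))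

∣⁅p,q⁆∪S∣≡2+∣S∣ : ∀ {n} {p q : Fin n} (S : Subset n) → p ≢ q → p ∉ S → q ∉ S →
                  ∣ ⁅ p , q ⁆∪ S ∣ ≡ 2 + ∣ S ∣
∣⁅p,q⁆∪S∣≡2+∣S∣ {p = p} {q} S p≢q p∉S q∉S =
  trans (∣⁅x⁆∪p∣≡1+∣p∣ p (⁅ q ⁆ ∪ S) p∉)
        (cong suc (∣⁅x⁆∪p∣≡1+∣p∣ q S q∉S))
  where
  p∉ : p ∉ ⁅ q ⁆ ∪ S
  p∉ p∈ with ∈⁅y⁆∪p⁻ p∈
  ... | inj₁ p≡q = p≢q p≡q
  ... | inj₂ p∈S = p∉S p∈S

module _ {n : ℕ} (G : Graph n) where

  adj-sym : ∀ {x y} → Adj G x y → Adj G y x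
  adj-sym {x} {y} x~y = trans (Graph.sym G y x) x~y

  adj⇒≢ : ∀ {x y} → Adj G x y → x ≢ y
  adj⇒≢ {x} x~x refl with trans (sym x~x) (Graph.irrefl G x)
  ... | ()

  adj⇒∈nbhd : ∀ {v z} → Adj G v z → z ∈ nbhd G v
  adj⇒∈nbhd {v} {z} v~z = lookup⇒[]= z _ (trans (lookup∘tabulate (Graph.adj G v) z) v~z)

  nbhd-exhausted : ∀ {v z} (S : Subset n) → S ⊆ nbhd G v → deg G v ≡ ∣ S ∣ →
                   Adj G v z → z ∈ S
  nbhd-exhausted {v} {z} S S⊆N degv v~z with z ∈? S
  ... | yes z∈S = z∈S
  ... | no  z∉S = ⊥-elim (1+n≰n too-many)
    where
    open ≤-Reasoning
    too-many : suc ∣ S ∣ ≤ ∣ S ∣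
    too-many = begin
      suc ∣ S ∣      ≡⟨ sym (∣⁅x⁆∪p∣≡1+∣p∣ z S z∉S) ⟩
      ∣ ⁅ z ⁆ ∪ S ∣  ≤⟨ p⊆q⇒∣p∣≤∣q∣ (⁅x⁆∪p⊆ (adj⇒∈nbhd v~z) S⊆N) ⟩
      deg G v        ≡⟨ degv ⟩
      ∣ S ∣          ∎

  deg≡1⇒nbhd : ∀ {v x z} → deg G v ≡ 1 → Adj G v x → Adj G v z → z ≡ x
  deg≡1⇒nbhd {v} {x} degv v~x v~z =
    x∈⁅y⁆⇒x≡y x (nbhd-exhausted ⁅ x ⁆ ⁅x⁆⊆N (trans degv (sym (∣⁅x⁆∣≡1 x))) v~z)
    where
    ⁅x⁆⊆N : ⁅ x ⁆ ⊆ nbhd G v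
    ⁅x⁆⊆N y∈ = subst (_∈ nbhd G v) (sym (x∈⁅y⁆⇒x≡y x y∈)) (adj⇒∈nbhd v~x)

  deg≡2⇒nbhd : ∀ {v x y z} → deg G v ≡ 2 → Adj G v x → Adj G v y → x ≢ y →
               Adj G v z → z ≡ x ⊎ z ≡ y
  deg≡2⇒nbhd {v} {x} {y} degv v~x v~y x≢y v~z
    with ∈⁅y⁆∪p⁻ (nbhd-exhausted (⁅ x ⁆ ∪ ⁅ y ⁆) xy⊆N size v~z)
    where
    xy⊆N : ⁅ x ⁆ ∪ ⁅ y ⁆ ⊆ nbhd G v
    xy⊆N = ⁅x⁆∪p⊆ (adj⇒∈nbhd v~x) λ z∈ →
             subst (_∈ nbhd G v) (sym (x∈⁅y⁆⇒x≡y y z∈)) (adj⇒∈nbhd v~y)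
    size : deg G v ≡ ∣ ⁅ x ⁆ ∪ ⁅ y ⁆ ∣
    size = trans degv (sym (trans (∣⁅x⁆∪p∣≡1+∣p∣ x ⁅ y ⁆ (x≢y ∘ x∈⁅y⁆⇒x≡y y))
                                  (cong suc (∣⁅x⁆∣≡1 y))))
  ... | inj₁ z≡x = inj₁ z≡x
  ... | inj₂ z∈⁅y⁆ = inj₂ (x∈⁅y⁆⇒x≡y y z∈⁅y⁆)

  -- p and q are apart if they coincide or have no common neighbour; an
  -- open packing of G is exactly a set of pairwise apart vertices.
  Apart : Fin n → Fin n → Set
  Apart p q = ∀ v → Adj G p v → Adj G q v → p ≡ q

  Apart-sym : ∀ {p q} → Apart p q → Apart q p
  Apart-sym p#q v q~v p~v = sym (p#q v p~v q~v)

  packing-insert : ∀ {p S} → (∀ {s} → s ∈ S → Apart s p) →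
                   IsOpenPacking G ⊤ S → IsOpenPacking G ⊤ (⁅ p ⁆ ∪ S)
  packing-insert {p} {S} apart (_ , disjoint) = (λ _ → ∈⊤) , disjoint′
    where
    disjoint′ : ∀ x y v → x ∈ ⁅ p ⁆ ∪ S → y ∈ ⁅ p ⁆ ∪ S → v ∈ ⊤ →
                Adj G x v → Adj G y v → x ≡ y
    disjoint′ x y v x∈ y∈ v∈ x~v y~v with ∈⁅y⁆∪p⁻ x∈ | ∈⁅y⁆∪p⁻ y∈
    ... | inj₁ refl | inj₁ refl = refl
    ... | inj₁ refl | inj₂ y∈S  = sym (apart y∈S v y~v x~v)
    ... | inj₂ x∈S  | inj₁ refl = apart x∈S v x~v y~v
    ... | inj₂ x∈S  | inj₂ y∈S  = disjoint x y v x∈S y∈S v∈ x~v y~v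

  packing-insert₂ : ∀ {p q S} → Apart p q →
                    (∀ {s} → s ∈ S → Apart s p) → (∀ {s} → s ∈ S → Apart s q) →
                    IsOpenPacking G ⊤ S → IsOpenPacking G ⊤ (⁅ p , q ⁆∪ S)
  packing-insert₂ {p} {q} {S} p#q S#p S#q packing =
    packing-insert apart-p (packing-insert S#q packing)
    where
    apart-p : ∀ {s} → s ∈ ⁅ q ⁆ ∪ S → Apart s p
    apart-p s∈ with ∈⁅y⁆∪p⁻ s∈
    ... | inj₁ refl = Apart-sym p#q
    ... | inj₂ s∈S  = S#p s∈S

  packing-restrict : ∀ {V W S} → W ⊆ V → IsOpenPacking G V S → IsOpenPacking G W (S ∩ W)
  packing-restrict {V} {W} {S} W⊆V (_ , disjoint) =
    (λ x∈ → proj₂ (x∈p∩q⁻ S W x∈)) ,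
    λ x y v x∈ y∈ v∈W → disjoint x y v (proj₁ (x∈p∩q⁻ S W x∈)) (proj₁ (x∈p∩q⁻ S W y∈)) (W⊆V v∈W)

  -- Of two vertices with a common neighbour, an open packing contains at
  -- most one: all its members among p, q equal a single vertex x.
  packing-at-most-one : ∀ {S p q m} → IsOpenPacking G ⊤ S → Adj G p m → Adj G q m →
                        Σ (Fin n) λ x → ∀ {z} → z ∈ S → z ≡ p ⊎ z ≡ q → z ≡ x
  packing-at-most-one {S} {p} {q} {m} (_ , disjoint) p~m q~m with q ∈? S
  ... | yes q∈S = q , λ { z∈S (inj₁ refl) → disjoint _ q m z∈S q∈S ∈⊤ p~m q~m
                        ; z∈S (inj₂ z≡q)  → z≡q }
  ... | no  q∉S = p , λ { z∈S (inj₁ z≡p)  → z≡p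
                        ; z∈S (inj₂ refl) → ⊥-elim (q∉S z∈S) }

record PendantPath {n : ℕ} (G : Graph n) (w a b c d : Fin n) : Set where
  field
    w~a : Adj G w a
    a~b : Adj G a b
    b~c : Adj G b c
    c~d : Adj G c d
    N-a : ∀ {z} → Adj G a z → z ≡ w ⊎ z ≡ b
    N-b : ∀ {z} → Adj G b z → z ≡ a ⊎ z ≡ c
    N-c : ∀ {z} → Adj G c z → z ≡ b ⊎ z ≡ d
    N-d : ∀ {z} → Adj G d z → z ≡ c
    w≢b : w ≢ b
    w≢c : w ≢ c
    w≢d : w ≢ d
    a≢c : a ≢ c
    a≢d : a ≢ d
    b≢d : b ≢ d

pendantPath-of-path : ∀ {n} (G : Graph n) (m : ℕ) (u : ℕ → Fin n) →
  IsPath G (4 + m) u → (∀ i → 1 ≤ i → i < 4 + m → deg G (u i) ≡ 2) →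
  deg G (u (4 + m)) ≡ 1 →
  PendantPath G (u m) (u (1 + m)) (u (2 + m)) (u (3 + m)) (u (4 + m))
pendantPath-of-path G m u (step , injective) deg2 deg1 = record
  { w~a = w~a ; a~b = a~b ; b~c = b~c ; c~d = c~d
  ; N-a = deg≡2⇒nbhd G (deg2 (1 + m) (s≤s z≤n) (m≤n+m (2 + m) 2)) (adj-sym G w~a) a~b w≢b
  ; N-b = deg≡2⇒nbhd G (deg2 (2 + m) (s≤s z≤n) (m≤n+m (3 + m) 1)) (adj-sym G a~b) b~c a≢c
  ; N-c = deg≡2⇒nbhd G (deg2 (3 + m) (s≤s z≤n) ≤-refl) (adj-sym G b~c) c~d b≢d
  ; N-d = deg≡1⇒nbhd G deg1 (adj-sym G c~d)
  ; w≢b = w≢b ; w≢c = w≢c ; w≢d = w≢d ; a≢c = a≢c ; a≢d = a≢d ; b≢d = b≢d }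
  where
  distinct : ∀ {i j} → i < j → j ≤ 4 + m → u i ≢ u j
  distinct i<j j≤ e = <⇒≢ i<j (injective _ _ (≤-trans (<⇒≤ i<j) j≤) j≤ e)
  w~a = step m       (m≤n+m (1 + m) 3)
  a~b = step (1 + m) (m≤n+m (2 + m) 2)
  b~c = step (2 + m) (m≤n+m (3 + m) 1)
  c~d = step (3 + m) ≤-refl
  w≢b = distinct (m<n+m m {2} (s≤s z≤n)) (m≤n+m (2 + m) 2)
  w≢c = distinct (m<n+m m {3} (s≤s z≤n)) (m≤n+m (3 + m) 1)
  w≢d = distinct (m<n+m m {4} (s≤s z≤n)) ≤-refl
  a≢c = distinct (m<n+m (1 + m) {2} (s≤s z≤n)) (m≤n+m (3 + m) 1)
  a≢d = distinct (m<n+m (1 + m) {3} (s≤s z≤n)) ≤-refl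
  b≢d = distinct (m<n+m (2 + m) {2} (s≤s z≤n)) ≤-refl

module PendantPathAnalysis {n : ℕ} {G : Graph n} {w a b c d : Fin n}
                           (P : PendantPath G w a b c d) where
  open PendantPath P

  w≢a : w ≢ a
  w≢a = adj⇒≢ G w~a
  a≢b : a ≢ b
  a≢b = adj⇒≢ G a~b
  b≢c : b ≢ c
  b≢c = adj⇒≢ G b~c
  c≢d : c ≢ d
  c≢d = adj⇒≢ G c~d

  OnPath : Fin n → Set
  OnPath v = v ≡ a ⊎ v ≡ b ⊎ v ≡ c ⊎ v ≡ d

  W : Subset n
  W = ∁ (⁅ a , b ⁆∪ (⁅ c ⁆ ∪ ⁅ d ⁆))

  ∉W⇒OnPath : ∀ {v} → v ∉ W → OnPath v
  ∉W⇒OnPath v∉W with ∈⁅p,q⁆∪S⁻ (x∉∁p⇒x∈p v∉W)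
  ... | inj₁ v≡a = inj₁ v≡a
  ... | inj₂ (inj₁ v≡b) = inj₂ (inj₁ v≡b)
  ... | inj₂ (inj₂ v∈cd) with ∈⁅y⁆∪p⁻ v∈cd
  ...   | inj₁ v≡c = inj₂ (inj₂ (inj₁ v≡c))
  ...   | inj₂ v∈d = inj₂ (inj₂ (inj₂ (x∈⁅y⁆⇒x≡y d v∈d)))

  OnPath⇒∉W : ∀ {v} → OnPath v → v ∉ W
  OnPath⇒∉W = x∈p⇒x∉∁p ∘ ∈⁅p,q⁆∪S⁺ ∘ inner
    where
    inner : ∀ {v} → OnPath v → v ≡ a ⊎ v ≡ b ⊎ v ∈ ⁅ c ⁆ ∪ ⁅ d ⁆
    inner (inj₁ v≡a)               = inj₁ v≡a
    inner (inj₂ (inj₁ v≡b))        = inj₂ (inj₁ v≡b)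
    inner (inj₂ (inj₂ (inj₁ refl))) = inj₂ (inj₂ (x∈p∪q⁺ (inj₁ (x∈⁅x⁆ c))))
    inner (inj₂ (inj₂ (inj₂ refl))) = inj₂ (inj₂ (x∈p∪q⁺ (inj₂ (x∈⁅x⁆ d))))

  a∉W : a ∉ W
  a∉W = OnPath⇒∉W (inj₁ refl)
  b∉W : b ∉ W
  b∉W = OnPath⇒∉W (inj₂ (inj₁ refl))
  c∉W : c ∉ W
  c∉W = OnPath⇒∉W (inj₂ (inj₂ (inj₁ refl)))
  d∉W : d ∉ W
  d∉W = OnPath⇒∉W (inj₂ (inj₂ (inj₂ refl)))

  w∈W : w ∈ W
  w∈W = x∉p⇒x∈∁p (λ w∈ → off-path (∉W⇒OnPath (x∈p⇒x∉∁p w∈)))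
    where
    off-path : ¬ OnPath w
    off-path (inj₁ e)               = w≢a e
    off-path (inj₂ (inj₁ e))        = w≢b e
    off-path (inj₂ (inj₂ (inj₁ e))) = w≢c e
    off-path (inj₂ (inj₂ (inj₂ e))) = w≢d e

  path-neighbour : ∀ {r z} → OnPath r → Adj G r z → (r ≡ a × z ≡ w) ⊎ OnPath z
  path-neighbour (inj₁ refl) a~z with N-a a~z
  ... | inj₁ z≡w = inj₁ (refl , z≡w)
  ... | inj₂ z≡b = inj₂ (inj₂ (inj₁ z≡b))
  path-neighbour (inj₂ (inj₁ refl)) b~z with N-b b~z
  ... | inj₁ z≡a = inj₂ (inj₁ z≡a)
  ... | inj₂ z≡c = inj₂ (inj₂ (inj₂ (inj₁ z≡c)))
  path-neighbour (inj₂ (inj₂ (inj₁ refl))) c~z with N-c c~z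
  ... | inj₁ z≡b = inj₂ (inj₂ (inj₁ z≡b))
  ... | inj₂ z≡d = inj₂ (inj₂ (inj₂ (inj₂ z≡d)))
  path-neighbour (inj₂ (inj₂ (inj₂ refl))) d~z = inj₂ (inj₂ (inj₂ (inj₁ (N-d d~z))))

  leave-W : ∀ {p v} → p ∈ W → Adj G p v → v ∉ W → p ≡ w × v ≡ a
  leave-W p∈W p~v v∉W with path-neighbour (∉W⇒OnPath v∉W) (adj-sym G p~v)
  ... | inj₁ (v≡a , p≡w) = p≡w , v≡a
  ... | inj₂ p-on-path   = ⊥-elim (OnPath⇒∉W p-on-path p∈W)

  shared-neighbour : ∀ {s r v} → s ∈ W → r ∉ W → Adj G s v → Adj G r v →
                     (r ≡ b × s ≡ w) ⊎ (r ≡ a × Adj G s w)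
  shared-neighbour {s} {r} s∈W r∉W s~v r~v with path-neighbour (∉W⇒OnPath r∉W) r~v
  ... | inj₁ (r≡a , refl) = inj₂ (r≡a , s~v)
  ... | inj₂ v-on-path with leave-W s∈W s~v (OnPath⇒∉W v-on-path)
  ...   | s≡w , refl with N-a (adj-sym G r~v)
  ...     | inj₁ refl = ⊥-elim (r∉W w∈W)
  ...     | inj₂ r≡b  = inj₁ (r≡b , s≡w)

  apart-c : ∀ {s} → s ∈ W → Apart G s c
  apart-c s∈W v s~v c~v with shared-neighbour s∈W c∉W s~v c~v
  ... | inj₁ (c≡b , _) = ⊥-elim (b≢c (sym c≡b))
  ... | inj₂ (c≡a , _) = ⊥-elim (a≢c (sym c≡a))

  apart-d : ∀ {s} → s ∈ W → Apart G s d
  apart-d s∈W v s~v d~v with shared-neighbour s∈W d∉W s~v d~v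
  ... | inj₁ (d≡b , _) = ⊥-elim (b≢d (sym d≡b))
  ... | inj₂ (d≡a , _) = ⊥-elim (a≢d (sym d≡a))

  apart-b : ∀ {s} → s ∈ W → s ≢ w → Apart G s b
  apart-b s∈W s≢w v s~v b~v with shared-neighbour s∈W b∉W s~v b~v
  ... | inj₁ (_ , s≡w) = ⊥-elim (s≢w s≡w)
  ... | inj₂ (b≡a , _) = ⊥-elim (a≢b (sym b≡a))

  apart-a : ∀ {s} → s ∈ W → ¬ Adj G s w → Apart G s a
  apart-a s∈W s≁w v s~v a~v with shared-neighbour s∈W a∉W s~v a~v
  ... | inj₁ (a≡b , _)   = ⊥-elim (a≢b a≡b)
  ... | inj₂ (_ , s~w)   = ⊥-elim (s≁w s~w)

  apart-cd : Apart G c d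
  apart-cd v c~v d~v with N-d d~v
  ... | refl = ⊥-elim (adj⇒≢ G c~v refl)

  apart-bc : Apart G b c
  apart-bc v b~v c~v with N-b b~v
  ... | inj₂ refl = ⊥-elim (adj⇒≢ G c~v refl)
  ... | inj₁ refl with N-c c~v
  ...   | inj₁ a≡b = ⊥-elim (a≢b a≡b)
  ...   | inj₂ a≡d = ⊥-elim (a≢d a≡d)

  apart-ad : Apart G a d
  apart-ad v a~v d~v with N-d d~v
  ... | refl with N-a a~v
  ...   | inj₁ c≡w = ⊥-elim (w≢c (sym c≡w))
  ...   | inj₂ c≡b = ⊥-elim (b≢c (sym c≡b))

  -- Since only w leaves W, an open packing of G[W] is one of G.
  packing-lift : ∀ {S} → IsOpenPacking G W S → IsOpenPacking G ⊤ S
  packing-lift {S} (S⊆W , disjoint) = (λ _ → ∈⊤) , disjoint′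
    where
    disjoint′ : ∀ x y v → x ∈ S → y ∈ S → v ∈ ⊤ → Adj G x v → Adj G y v → x ≡ y
    disjoint′ x y v x∈ y∈ _ x~v y~v with v ∈? W
    ... | yes v∈W = disjoint x y v x∈ y∈ v∈W x~v y~v
    ... | no  v∉W = trans (proj₁ (leave-W (S⊆W x∈) x~v v∉W))
                          (sym (proj₁ (leave-W (S⊆W y∈) y~v v∉W)))

  extend-cd : ∀ {S} → IsOpenPacking G W S → IsOpenPacking G ⊤ (⁅ c , d ⁆∪ S)
  extend-cd packing@(S⊆W , _) =
    packing-insert₂ G apart-cd (apart-c ∘ S⊆W) (apart-d ∘ S⊆W) (packing-lift packing)

  extension-size : ∀ {p q S} → S ⊆ W → p ≢ q → p ∉ W → q ∉ W →
                   ∣ ⁅ p , q ⁆∪ S ∣ ≡ 2 + ∣ S ∣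
  extension-size {S = S} S⊆W p≢q p∉W q∉W =
    ∣⁅p,q⁆∪S∣≡2+∣S∣ S p≢q (p∉W ∘ S⊆W) (q∉W ∘ S⊆W)

  extension-restrict : ∀ {S} → S ⊆ W → (⁅ c , d ⁆∪ S) ∩ W ≡ S
  extension-restrict {S} S⊆W = ⊆-antisym shrink (λ x∈S → x∈p∩q⁺ (∈⁅p,q⁆∪S⁺ (inj₂ (inj₂ x∈S)) , S⊆W x∈S))
    where
    shrink : (⁅ c , d ⁆∪ S) ∩ W ⊆ S
    shrink x∈ with x∈p∩q⁻ (⁅ c , d ⁆∪ S) W x∈
    ... | x∈ext , x∈W with ∈⁅p,q⁆∪S⁻ x∈ext
    ...   | inj₁ refl        = ⊥-elim (c∉W x∈W)
    ...   | inj₂ (inj₁ refl) = ⊥-elim (d∉W x∈W)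
    ...   | inj₂ (inj₂ x∈S)  = x∈S

  -- An open packing of G has at most two vertices on the path: one of a, c
  -- (common neighbour b) and one of b, d (common neighbour c).
  packing-bound : ∀ {S} → IsOpenPacking G ⊤ S → ∣ S ∣ ≤ 2 + ∣ S ∩ W ∣
  packing-bound {S} packing = ≤-trans (p⊆q⇒∣p∣≤∣q∣ S⊆) (∣⁅p,q⁆∪S∣≤2+∣S∣ x y (S ∩ W))
    where
    ac = packing-at-most-one G packing a~b (adj-sym G b~c)
    bd = packing-at-most-one G packing b~c (adj-sym G c~d)
    x = proj₁ ac
    y = proj₁ bd
    S⊆ : S ⊆ ⁅ x , y ⁆∪ (S ∩ W)
    S⊆ {z} z∈S with z ∈? W
    ... | yes z∈W = ∈⁅p,q⁆∪S⁺ (inj₂ (inj₂ (x∈p∩q⁺ (z∈S , z∈W))))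
    ... | no  z∉W with ∉W⇒OnPath z∉W
    ...   | inj₁ z≡a               = ∈⁅p,q⁆∪S⁺ (inj₁ (proj₂ ac z∈S (inj₁ z≡a)))
    ...   | inj₂ (inj₁ z≡b)        = ∈⁅p,q⁆∪S⁺ (inj₂ (inj₁ (proj₂ bd z∈S (inj₁ z≡b))))
    ...   | inj₂ (inj₂ (inj₁ z≡c)) = ∈⁅p,q⁆∪S⁺ (inj₁ (proj₂ ac z∈S (inj₂ z≡c)))
    ...   | inj₂ (inj₂ (inj₂ z≡d)) = ∈⁅p,q⁆∪S⁺ (inj₂ (inj₁ (proj₂ bd z∈S (inj₂ z≡d))))

  P4Edge-sym : ∀ {x y} → P4Edge G w a b c d x y → P4Edge G w a b c d y x
  P4Edge-sym (inj₁ (e₁ , e₂))                                          = inj₂ (inj₁ (e₂ , e₁))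
  P4Edge-sym (inj₂ (inj₁ (e₁ , e₂)))                                   = inj₁ (e₂ , e₁)
  P4Edge-sym (inj₂ (inj₂ (inj₁ (e₁ , e₂))))                            = inj₂ (inj₂ (inj₂ (inj₁ (e₂ , e₁))))
  P4Edge-sym (inj₂ (inj₂ (inj₂ (inj₁ (e₁ , e₂)))))                     = inj₂ (inj₂ (inj₁ (e₂ , e₁)))
  P4Edge-sym (inj₂ (inj₂ (inj₂ (inj₂ (inj₁ (e₁ , e₂))))))              = inj₂ (inj₂ (inj₂ (inj₂ (inj₂ (inj₁ (e₂ , e₁))))))
  P4Edge-sym (inj₂ (inj₂ (inj₂ (inj₂ (inj₂ (inj₁ (e₁ , e₂)))))))       = inj₂ (inj₂ (inj₂ (inj₂ (inj₁ (e₂ , e₁)))))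
  P4Edge-sym (inj₂ (inj₂ (inj₂ (inj₂ (inj₂ (inj₂ (inj₁ (e₁ , e₂)))))))) = inj₂ (inj₂ (inj₂ (inj₂ (inj₂ (inj₂ (inj₂ (e₂ , e₁)))))))
  P4Edge-sym (inj₂ (inj₂ (inj₂ (inj₂ (inj₂ (inj₂ (inj₂ (e₁ , e₂)))))))) = inj₂ (inj₂ (inj₂ (inj₂ (inj₂ (inj₂ (inj₁ (e₂ , e₁)))))))

  path-edge : ∀ {x y} → OnPath x → Adj G x y → P4Edge G w a b c d x y
  path-edge (inj₁ refl) a~y with N-a a~y
  ... | inj₁ y≡w = inj₂ (inj₁ (refl , y≡w))
  ... | inj₂ y≡b = inj₂ (inj₂ (inj₁ (refl , y≡b)))
  path-edge (inj₂ (inj₁ refl)) b~y with N-b b~y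
  ... | inj₁ y≡a = inj₂ (inj₂ (inj₂ (inj₁ (refl , y≡a))))
  ... | inj₂ y≡c = inj₂ (inj₂ (inj₂ (inj₂ (inj₁ (refl , y≡c)))))
  path-edge (inj₂ (inj₂ (inj₁ refl))) c~y with N-c c~y
  ... | inj₁ y≡b = inj₂ (inj₂ (inj₂ (inj₂ (inj₂ (inj₁ (refl , y≡b))))))
  ... | inj₂ y≡d = inj₂ (inj₂ (inj₂ (inj₂ (inj₂ (inj₂ (inj₁ (refl , y≡d)))))))
  path-edge (inj₂ (inj₂ (inj₂ refl))) d~y = inj₂ (inj₂ (inj₂ (inj₂ (inj₂ (inj₂ (inj₂ (refl , N-d d~y)))))))

  P4Edge⇒Adj : ∀ {x y} → P4Edge G w a b c d x y → Adj G x y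
  P4Edge⇒Adj (inj₁ (refl , refl))                                          = w~a
  P4Edge⇒Adj (inj₂ (inj₁ (refl , refl)))                                   = adj-sym G w~a
  P4Edge⇒Adj (inj₂ (inj₂ (inj₁ (refl , refl))))                            = a~b
  P4Edge⇒Adj (inj₂ (inj₂ (inj₂ (inj₁ (refl , refl)))))                     = adj-sym G a~b
  P4Edge⇒Adj (inj₂ (inj₂ (inj₂ (inj₂ (inj₁ (refl , refl))))))              = b~c
  P4Edge⇒Adj (inj₂ (inj₂ (inj₂ (inj₂ (inj₂ (inj₁ (refl , refl)))))))       = adj-sym G b~c
  P4Edge⇒Adj (inj₂ (inj₂ (inj₂ (inj₂ (inj₂ (inj₂ (inj₁ (refl , refl)))))))) = c~d
  P4Edge⇒Adj (inj₂ (inj₂ (inj₂ (inj₂ (inj₂ (inj₂ (inj₂ (refl , refl)))))))) = adj-sym G c~d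

  p4-append : IsP4Append G W w a b c d
  p4-append = w∈W , a∉W , b∉W , c∉W , d∉W , a≢b , a≢c , a≢d , b≢c , b≢d , c≢d , cover , edges
    where
    cover : ∀ v → v ∈ W ⊎ OnPath v
    cover v with v ∈? W
    ... | yes v∈W = inj₁ v∈W
    ... | no  v∉W = inj₂ (∉W⇒OnPath v∉W)
    edges : ∀ x y → x ∉ W ⊎ y ∉ W →
            (Adj G x y → P4Edge G w a b c d x y) × (P4Edge G w a b c d x y → Adj G x y)
    edges x y (inj₁ x∉W) = path-edge (∉W⇒OnPath x∉W) , P4Edge⇒Adj
    edges x y (inj₂ y∉W) = (λ x~y → P4Edge-sym (path-edge (∉W⇒OnPath y∉W) (adj-sym G x~y))) ,
                           P4Edge⇒Adj

  module Transfer (U' : Subset n) (U'-unique : IsUniqueMaxOpenPacking G ⊤ U') where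

    U : Subset n
    U = U' ∩ W

    U'-packing : IsOpenPacking G ⊤ U'
    U'-packing = proj₁ (proj₁ U'-unique)

    U'-max : ∀ S → IsOpenPacking G ⊤ S → ∣ S ∣ ≤ ∣ U' ∣
    U'-max = proj₂ (proj₁ U'-unique)

    U-packing : IsOpenPacking G W U
    U-packing = packing-restrict G (λ _ → ∈⊤) U'-packing

    U⊆W : U ⊆ W
    U⊆W = proj₁ U-packing

    U-max : ∀ S → IsOpenPacking G W S → ∣ S ∣ ≤ ∣ U ∣
    U-max S packing = +-cancelˡ-≤ 2 ∣ S ∣ ∣ U ∣ (begin
      2 + ∣ S ∣            ≡⟨ sym (extension-size (proj₁ packing) c≢d c∉W d∉W) ⟩
      ∣ ⁅ c , d ⁆∪ S ∣     ≤⟨ U'-max _ (extend-cd packing) ⟩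
      ∣ U' ∣               ≤⟨ packing-bound U'-packing ⟩
      2 + ∣ U ∣            ∎)
      where open ≤-Reasoning

    -- Adding two path vertices to a maximum packing of G[W] gives, if it is
    -- an open packing at all, a maximum one of G, hence U'.
    extension-is-U' : ∀ {p q S} → p ≢ q → p ∉ W → q ∉ W → S ⊆ W → ∣ U ∣ ≤ ∣ S ∣ →
                      IsOpenPacking G ⊤ (⁅ p , q ⁆∪ S) → ⁅ p , q ⁆∪ S ≡ U'
    extension-is-U' {p} {q} {S} p≢q p∉W q∉W S⊆W U≤S packing =
      proj₂ U'-unique _ (packing , λ S' S'-packing → begin
        ∣ S' ∣             ≤⟨ U'-max S' S'-packing ⟩
        ∣ U' ∣             ≤⟨ packing-bound U'-packing ⟩
        2 + ∣ U ∣          ≤⟨ s≤s (s≤s U≤S) ⟩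
        2 + ∣ S ∣          ≡⟨ sym (extension-size S⊆W p≢q p∉W q∉W) ⟩
        ∣ ⁅ p , q ⁆∪ S ∣   ∎)
      where open ≤-Reasoning

    U-unique : ∀ S → IsMaxOpenPacking G W S → S ≡ U
    U-unique S (packing@(S⊆W , _) , S-max) = begin
      S                      ≡⟨ sym (extension-restrict S⊆W) ⟩
      (⁅ c , d ⁆∪ S) ∩ W     ≡⟨ cong (_∩ W) (extension-is-U' c≢d c∉W d∉W S⊆W
                                  (S-max U U-packing) (extend-cd packing)) ⟩
      U                      ∎
      where open Relation.Binary.PropositionalEquality.≡-Reasoning

    U-is-unique-max : IsUniqueMaxOpenPacking G W U
    U-is-unique-max = (U-packing , U-max) , U-unique

    only-cd-extends : ∀ {p q} → p ≢ q → p ∉ W → q ∉ W →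
                      IsOpenPacking G ⊤ (⁅ p , q ⁆∪ U) → p ≡ c ⊎ p ≡ d
    only-cd-extends {p} {q} p≢q p∉W q∉W packing
      with ∈⁅p,q⁆∪S⁻ (subst (p ∈_) (trans U'≡pqU (sym U'≡cdU)) (∈⁅p,q⁆∪S⁺ (inj₁ refl)))
      where
      U'≡pqU : ⁅ p , q ⁆∪ U ≡ U'
      U'≡pqU = extension-is-U' p≢q p∉W q∉W U⊆W ≤-refl packing
      U'≡cdU : ⁅ c , d ⁆∪ U ≡ U'
      U'≡cdU = extension-is-U' c≢d c∉W d∉W U⊆W ≤-refl (extend-cd U-packing)
    ... | inj₁ p≡c         = inj₁ p≡c
    ... | inj₂ (inj₁ p≡d)  = inj₂ p≡d
    ... | inj₂ (inj₂ p∈U)  = ⊥-elim (p∉W (U⊆W p∈U))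

    -- If w ∉ U, then U ∪ {b, c} would be a second extension.
    w∈U : w ∈ U
    w∈U with w ∈? U
    ... | yes w∈U = w∈U
    ... | no  w∉U with only-cd-extends b≢c b∉W c∉W
                         (packing-insert₂ G apart-bc U#b (apart-c ∘ U⊆W) (packing-lift U-packing))
      where
      U#b : ∀ {s} → s ∈ U → Apart G s b
      U#b s∈U = apart-b (U⊆W s∈U) λ { refl → w∉U s∈U }
    ...   | inj₁ b≡c = ⊥-elim (b≢c b≡c)
    ...   | inj₂ b≡d = ⊥-elim (b≢d b≡d)

    -- If w has no neighbour in U, then U ∪ {a, d} would be a second extension.
    NeighbourOfwInU : Fin n → Set
    NeighbourOfwInU v = v ∈ W × Adj G w v × v ∈ U

    neighbour-of-w-in-U : Σ (Fin n) NeighbourOfwInU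
    neighbour-of-w-in-U with any? (λ v → v ∈? W ×-dec ((Graph.adj G w v ≟𝔹 true) ×-dec (v ∈? U)))
    ... | yes found = found
    ... | no  none with only-cd-extends a≢d a∉W d∉W
                         (packing-insert₂ G apart-ad U#a (apart-d ∘ U⊆W) (packing-lift U-packing))
      where
      U#a : ∀ {s} → s ∈ U → Apart G s a
      U#a {s} s∈U = apart-a (U⊆W s∈U) λ s~w → none (s , U⊆W s∈U , adj-sym G s~w , s∈U)
    ...   | inj₁ a≡c = ⊥-elim (a≢c a≡c)
    ...   | inj₂ a≡d = ⊥-elim (a≢d a≡d)

    op1-allowed : Op1Allowed G W w
    op1-allowed = w∈W , U , U-is-unique-max , w∈U , neighbour-of-w-in-U

mainTheorem19 : {n : ℕ} (T' : Graph n) → IsTree T' →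
    HasUniqueMaxOpenPacking T' ⊤ → MaxDegAtLeast3 T' →
    (x : Fin n) → LLeaf T' x →
    (k : ℕ) (u : ℕ → Fin n) → 4 ≤ k → u 0 ≡ x → IsPath T' k u →
    (∀ i → 1 ≤ i → i < k → deg T' (u i) ≡ 2) → deg T' (u k) ≡ 1 →
    HasUniqueMaxOpenPacking T' (remaining k u) ×
    ObtainableByOp1 T' (remaining k u) (u (k ∸ 4))
mainTheorem19 T' _ (U' , U'-unique) _ _ _ (suc (suc (suc (suc m)))) u (s≤s (s≤s (s≤s (s≤s _)))) _
              path deg2 deg1 =
  (U , U-is-unique-max) , op1-allowed , _ , _ , _ , _ , p4-append
  where
  open PendantPathAnalysis (pendantPath-of-path T' m u path deg2 deg1)
  open Transfer U' U'-unique
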